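{- Let $\Delta$ be of type $G_2$ with simple roots $\alpha_1,\alpha_2$, and let $(\beta_1,\dots,\beta_6)$ be either $(\alpha_1,3\alpha_1+\alpha_2,2\alpha_1+\alpha_2,3\alpha_1+2\alpha_2,\alpha_1+\alpha_2,\alpha_2)$ or $(\alpha_2,\alpha_1+\alpha_2,3\alpha_1+2\alpha_2,2\alpha_1+\alpha_2,3\alpha_1+\alpha_2,\alpha_1)$. For $k=0,\dots,6$ define on $K[W]$: $\mathsf T_k^{\pm}=\mathsf R_{\pm\beta_{k+1}}\cdots\mathsf R_{\pm\beta_6}\mathsf R_{\mp\beta_1}\cdots\mathsf R_{\mp\beta_k}$, $\mathsf S_k=\mathsf R_{\beta_{k+1}}\cdots\mathsf R_{\beta_6}\mathsf R_{\beta_1}\cdots\mathsf R_{\beta_k}$, $\mathsf S'_k=\mathsf R_{\beta_k}\cdots\mathsf R_{\beta_1}\mathsf R_{\beta_6}\cdots\mathsf R_{\beta_{k+1}}$. Then for each $k=0,\dots,6$: (1) every entry of the matrix of $\mathsf S_k$ is of the form $\sum_{j=1}^rm_jQ^{\xi_j}$ with pairwise distinct $\xi_j\in Q^{\vee,+}$ and $m_j\in\{1,2,3\}$; (2) for $v,w\in W$, if the $(v,w)$-entry of $\mathsf S_k$ is $\sum_jm_jQ^{\xi_j}$ as in (1) and the $(v,w)$-entry of $\mathsf T_k^\pm$ is $\sum_\xi n^\pm_\xi Q^\xi$, then for each $j$: $m_j=2$ implies $n^\pm_{\xi_j}=0$, and $m_j\in\{1,3\}$ implies $n^\pm_{\xi_j}\in\{1,-1\}$;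 moreover $n^\pm_\xi=0$ for $\xi\notin\{\xi_1,\dots,\xi_r\}$; (3) for $v,w\in W$, if the $(v,w)$-entry of $\mathsf S_k$ is $\sum_jm_jQ^{\xi_j}$ as in (1) and the $(v,w)$-entry of $\mathsf S'_k$ is $\sum_\xi n_\xi Q^\xi$, then for each $j$: $m_j=2$ implies $n_{\xi_j}\in\{0,2\}$; $m_j=1$ implies $n_{\xi_j}\in\{1,3\}$; and $m_j=3$ implies $n_{\xi_j}=1$.
   Context: $W$ is the Weyl group of type $G_2$ with length $\ell$, reflections $s_\gamma$, $\rho=\frac12\sum_{\gamma\in\Delta^+}\gamma$, $Q^{\vee,+}=\mathbb Z_{\ge0}\alpha_1^\vee+\mathbb Z_{\ge0}\alpha_2^\vee$. $\mathrm{QBG}(W)$: vertices $W$, edges $x\xrightarrow{\gamma}xs_\gamma$ ($\gamma\in\Delta^+$) when $\ell(xs_\gamma)=\ell(x)+1$ (Bruhat edge) or $\ell(xs_\gamma)=\ell(x)-2\langle\rho,\gamma^\vee\rangle+1$ (quantum edge). $K$ is a field containing $\mathbb C[[Q_1,Q_2]]$ and $Q^{m_1\alpha_1^\vee+m_2\alpha_2^\vee}=Q_1^{m_1}Q_2^{m_2}$. For $\gamma\in\Delta^+$, $\mathsf Q_\gamma$ is the $K$-linear operator on $K[W]$ with $\mathsf Q_\gamma v=vs_\gamma$ for a Bruhat edge $v\to vs_\gamma$, $Q^{\gamma^\vee}vs_\gamma$ for a quantum edge, $0$ otherwise; $\mathsf Q_{ -\gamma}=-\mathsf Q_\gamma$,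 $\mathsf R_\gamma=1+\mathsf Q_\gamma$. The matrix of $\mathsf T$ is $(c_{v,w})$ with $\mathsf Tw=\sum_vc_{v,w}v$. -}

module Defs where

open import Data.Nat as ℕ using (ℕ; zero; suc)
open import Data.Integer as ℤ using (ℤ; +_; -_; _*_; _+_; _-_)
open import Data.Bool using (Bool; true; false; if_then_else_; _∧_)
open import Data.Product using (_×_; _,_; proj₁; proj₂)
open import Data.List using (List; []; _∷_; _++_; map; concatMap; foldr; take; drop; reverse; sum)
open import Data.Fin using (Fin)
open import Data.Fin.Properties using (≡-decSetoid)
open import Data.List.Base using (allFin)
open import Relation.Nullary using (does)
open import Relation.Binary.PropositionalEquality using (_≡_)

-- Roots are written aα₁ + bα₂ ↦ (a , b) ∈ ℤ², coroots cα₁^∨ + dα₂^∨ ↦ (c , d).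
-- α₁ is short, α₂ long; Cartan integers
--   ⟨α₁,α₁^∨⟩ = 2, ⟨α₁,α₂^∨⟩ = -1, ⟨α₂,α₁^∨⟩ = -3, ⟨α₂,α₂^∨⟩ = 2.

Vec2 : Set
Vec2 = ℤ × ℤ

pair : Vec2 → ℕ × ℕ → ℤ
pair (a , b) (c , d) =
  a * ((+ 2) * (+ c) - (+ d)) + b * ((+ 2) * (+ d) - (+ 3) * (+ c))

data PosRoot : Set where
  α₁ α₂ α₁+α₂ 2α₁+α₂ 3α₁+α₂ 3α₁+2α₂ : PosRoot

posRoots : List PosRoot
posRoots = α₁ ∷ α₂ ∷ α₁+α₂ ∷ 2α₁+α₂ ∷ 3α₁+α₂ ∷ 3α₁+2α₂ ∷ []

root : PosRoot → Vec2
root α₁       = (+ 1 , + 0)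
root α₂       = (+ 0 , + 1)
root α₁+α₂    = (+ 1 , + 1)
root 2α₁+α₂   = (+ 2 , + 1)
root 3α₁+α₂   = (+ 3 , + 1)
root 3α₁+2α₂  = (+ 3 , + 2)

-- coroot γ^∨ = 2γ/(γ,γ), with (α₁,α₁) = 2, (α₂,α₂) = 6, so α₁ = α₁^∨, α₂ = 3α₂^∨
coroot : PosRoot → ℕ × ℕ
coroot α₁       = (1 , 0)
coroot α₂       = (0 , 1)
coroot α₁+α₂    = (1 , 3)
coroot 2α₁+α₂   = (2 , 3)
coroot 3α₁+α₂   = (1 , 1)
coroot 3α₁+2α₂  = (1 , 2)

-- ⟨ρ , γ^∨⟩ = height of the coroot (ρ = ϖ₁ + ϖ₂)
rhoPair : PosRoot → ℕ
rhoPair γ = proj₁ (coroot γ) ℕ.+ proj₂ (coroot γ)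

-- Linear maps of the root lattice: (image of α₁ , image of α₂)

Mat : Set
Mat = Vec2 × Vec2

app : Mat → Vec2 → Vec2
app ((p , q) , (r , s)) (a , b) = (a * p + b * r , a * q + b * s)

_∘ₘ_ : Mat → Mat → Mat
f ∘ₘ g = (app f (proj₁ g) , app f (proj₂ g))

idM : Mat
idM = ((+ 1 , + 0) , (+ 0 , + 1))

refl-s : PosRoot → Mat
refl-s γ = (sx (+ 1 , + 0) , sx (+ 0 , + 1))
  where
  sx : Vec2 → Vec2
  sx x = (proj₁ x - pair x (coroot γ) * proj₁ (root γ)
         , proj₂ x - pair x (coroot γ) * proj₂ (root γ))

eqℤ : ℤ → ℤ → Bool
eqℤ x y = does (x ℤ.≟ y)

eqV : Vec2 → Vec2 → Bool
eqV (a , b) (c , d) = eqℤ a c ∧ eqℤ b d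

eqM : Mat → Mat → Bool
eqM (x , y) (z , w) = eqV x z ∧ eqV y w

-- The Weyl group W(G₂): 12 elements, given by reduced words in s₁ = s_{α₁}, s₂ = s_{α₂}

W : Set
W = Fin 12

word : Fin 12 → List PosRoot
word Fin.zero = []
word (Fin.suc Fin.zero) = α₁ ∷ []
word (Fin.suc (Fin.suc Fin.zero)) = α₂ ∷ []
word (Fin.suc (Fin.suc (Fin.suc Fin.zero))) = α₁ ∷ α₂ ∷ []
word (Fin.suc (Fin.suc (Fin.suc (Fin.suc Fin.zero)))) = α₂ ∷ α₁ ∷ []
word (Fin.suc (Fin.suc (Fin.suc (Fin.suc (Fin.suc Fin.zero))))) = α₁ ∷ α₂ ∷ α₁ ∷ []
word (Fin.suc (Fin.suc (Fin.suc (Fin.suc (Fin.suc (Fin.suc Fin.zero)))))) = α₂ ∷ α₁ ∷ α₂ ∷ []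
word (Fin.suc (Fin.suc (Fin.suc (Fin.suc (Fin.suc (Fin.suc (Fin.suc Fin.zero))))))) = α₁ ∷ α₂ ∷ α₁ ∷ α₂ ∷ []
word (Fin.suc (Fin.suc (Fin.suc (Fin.suc (Fin.suc (Fin.suc (Fin.suc (Fin.suc Fin.zero)))))))) = α₂ ∷ α₁ ∷ α₂ ∷ α₁ ∷ []
word (Fin.suc (Fin.suc (Fin.suc (Fin.suc (Fin.suc (Fin.suc (Fin.suc (Fin.suc (Fin.suc Fin.zero))))))))) = α₁ ∷ α₂ ∷ α₁ ∷ α₂ ∷ α₁ ∷ []
word (Fin.suc (Fin.suc (Fin.suc (Fin.suc (Fin.suc (Fin.suc (Fin.suc (Fin.suc (Fin.suc (Fin.suc Fin.zero)))))))))) = α₂ ∷ α₁ ∷ α₂ ∷ α₁ ∷ α₂ ∷ []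
word (Fin.suc (Fin.suc (Fin.suc (Fin.suc (Fin.suc (Fin.suc (Fin.suc (Fin.suc (Fin.suc (Fin.suc (Fin.suc Fin.zero))))))))))) = α₁ ∷ α₂ ∷ α₁ ∷ α₂ ∷ α₁ ∷ α₂ ∷ []

mat : W → Mat
mat w = foldr (λ γ m → refl-s γ ∘ₘ m) idM (word w)

isNeg : Vec2 → Bool
isNeg (a , b) = does (a ℤ.<? + 0) Data.Bool.∨ does (b ℤ.<? + 0)
  where import Data.Bool

lengthM : Mat → ℕ
lengthM m = Data.List.length (Data.List.filterᵇ (λ γ → isNeg (app m (root γ))) posRoots)

ℓ : W → ℕ
ℓ w = lengthM (mat w)

-- Polynomials in Q₁, Q₂ with integer coefficients (⊂ ℂ[[Q₁,Q₂]] ⊂ K),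
-- as finite formal sums of terms c·Q₁^m₁ Q₂^m₂ ; only their coefficients matter.

Poly : Set
Poly = List ((ℕ × ℕ) × ℤ)

0ₚ : Poly
0ₚ = []

1ₚ : Poly
1ₚ = ((0 , 0) , + 1) ∷ []

-- Q^ξ for ξ = m₁α₁^∨ + m₂α₂^∨ ↦ (m₁ , m₂)
Qpow : ℕ × ℕ → Poly
Qpow ξ = (ξ , + 1) ∷ []

_+ₚ_ : Poly → Poly → Poly
_+ₚ_ = _++_

-ₚ_ : Poly → Poly
-ₚ p = map (λ t → (proj₁ t , - proj₂ t)) p

_*ₚ_ : Poly → Poly → Poly
p *ₚ q = concatMap (λ s → map (λ t →
  ((proj₁ (proj₁ s) ℕ.+ proj₁ (proj₁ t) , proj₂ (proj₁ s) ℕ.+ proj₂ (proj₁ t))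
  , proj₂ s * proj₂ t)) q) p

eqξ : ℕ × ℕ → ℕ × ℕ → Bool
eqξ (a , b) (c , d) = (a ℕ.≡ᵇ c) ∧ (b ℕ.≡ᵇ d)

coeff : Poly → ℕ × ℕ → ℤ
coeff p ξ = foldr (λ t acc → (if eqξ (proj₁ t) ξ then proj₂ t else + 0) + acc) (+ 0) p

-- Operators on K[W], represented by their matrices: Op T v w = c_{v,w}, T w = Σ_v c_{v,w} v.

Op : Set
Op = W → W → Poly

idOp : Op
idOp v w = if does (v Data.Fin.≟ w) then 1ₚ else 0ₚ

_+ₒ_ : Op → Op → Op
(A +ₒ B) v w = A v w +ₚ B v w

-ₒ_ : Op → Op
(-ₒ A) v w = -ₚ A v w

_·ₒ_ : Op → Op → Op
(A ·ₒ B) v w = foldr _+ₚ_ 0ₚ (map (λ u → A v u *ₚ B u w) (allFin 12))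

isBruhat : W → PosRoot → Bool
isBruhat x γ = ℓᵐ ℕ.≡ᵇ suc (ℓ x)
  where ℓᵐ = lengthM (mat x ∘ₘ refl-s γ)

isQuantum : W → PosRoot → Bool
isQuantum x γ = eqℤ (+ lengthM (mat x ∘ₘ refl-s γ))
                    ((+ ℓ x) - (+ 2) * (+ rhoPair γ) + (+ 1))

Qop : PosRoot → Op
Qop γ v w =
  if eqM (mat v) (mat w ∘ₘ refl-s γ)
  then (if isBruhat w γ then 1ₚ else if isQuantum w γ then Qpow (coroot γ) else 0ₚ)
  else 0ₚ

data Sign : Set where
  plus minus : Sign

flip : Sign → Sign
flip plus = minus
flip minus = plus

Qsigned : Sign → PosRoot → Op
Qsigned plus γ = Qop γ
Qsigned minus γ = -ₒ Qop γ

Rop : Sign → PosRoot → Op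
Rop ε γ = idOp +ₒ Qsigned ε γ

Rprod : Sign → List PosRoot → Op
Rprod ε = foldr (λ γ A → Rop ε γ ·ₒ A) idOp

data Choice : Set where
  first second : Choice

βs : Choice → List PosRoot
βs first  = α₁ ∷ 3α₁+α₂ ∷ 2α₁+α₂ ∷ 3α₁+2α₂ ∷ α₁+α₂ ∷ α₂ ∷ []
βs second = α₂ ∷ α₁+α₂ ∷ 3α₁+2α₂ ∷ 2α₁+α₂ ∷ 3α₁+α₂ ∷ α₁ ∷ []

Top : Choice → Sign → ℕ → Op
Top c ε k = Rprod ε (drop k (βs c)) ·ₒ Rprod (flip ε) (take k (βs c))

Sop : Choice → ℕ → Op
Sop c k = Rprod plus (drop k (βs c)) ·ₒ Rprod plus (take k (βs c))

S'op : Choice → ℕ → Op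
S'op c k = Rprod plus (reverse (take k (βs c))) ·ₒ Rprod plus (reverse (drop k (βs c)))

-- "p = Σ_{j=1}^r m_j Q^{ξ_j} with pairwise distinct ξ_j ∈ Q^{∨,+} and m_j ∈ {1,2,3}",
-- the data being the list L = [(ξ₁,m₁),…,(ξ_r,m_r)].

open import Data.List.Relation.Unary.All using (All)
open import Data.List.Relation.Unary.Unique.Propositional using (Unique)
open import Data.List.Membership.Propositional using (_∈_; _∉_)
open import Data.Sum using (_⊎_)

sumCoeff : List ((ℕ × ℕ) × ℕ) → ℕ × ℕ → ℤ
sumCoeff L ξ = foldr (λ t acc → (if eqξ (proj₁ t) ξ then + (proj₂ t) else + 0) + acc) (+ 0) L

IsForm : List ((ℕ × ℕ) × ℕ) → Poly → Set
IsForm L p =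
  Unique (map proj₁ L)
  × All (λ t → proj₂ t ≡ 1 ⊎ proj₂ t ≡ 2 ⊎ proj₂ t ≡ 3) L
  × (∀ ξ → coeff p ξ ≡ sumCoeff L ξ)

Cond2 : List ((ℕ × ℕ) × ℕ) → Poly → Set
Cond2 L p =
  All (λ t → (proj₂ t ≡ 2 → coeff p (proj₁ t) ≡ + 0)
           × (proj₂ t ≡ 1 ⊎ proj₂ t ≡ 3 →
                coeff p (proj₁ t) ≡ + 1 ⊎ coeff p (proj₁ t) ≡ - (+ 1))) L
  × (∀ ξ → ξ ∉ map proj₁ L → coeff p ξ ≡ + 0)

Cond3 : List ((ℕ × ℕ) × ℕ) → Poly → Set
Cond3 L p =
  All (λ t → (proj₂ t ≡ 2 → coeff p (proj₁ t) ≡ + 0 ⊎ coeff p (proj₁ t) ≡ + 2)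
           × (proj₂ t ≡ 1 → coeff p (proj₁ t) ≡ + 1 ⊎ coeff p (proj₁ t) ≡ + 3)
           × (proj₂ t ≡ 3 → coeff p (proj₁ t) ≡ + 1)) L

-- All operators involved are explicit 12 × 12 matrices over ℤ[Q₁, Q₂], so the
-- proposition is a finite computation. Each part is a condition on the coefficients
-- of single monomials Q^ξ: for (1) every coefficient of 𝖲ₖ must lie in {0,…,3}, and
-- the form Σ mⱼ Q^{ξⱼ} is then read off from the nonzero ones; (2) and (3) relate the
-- coefficients of 𝖲ₖ and of 𝖳ₖ^± resp. 𝖲'ₖ at the same ξ. Such a condition holds
-- trivially where both coefficients vanish, so it only has to be checked at the
-- finitely many exponents occurring in the polynomials, which is done by evaluation.
module Submission where

open import Defs
open import Data.Nat as ℕ using (ℕ; _≤_; z≤n; s≤s)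
open import Data.Integer as ℤ using (ℤ; +_; -_; _+_; ∣_∣)
open import Data.Integer.Properties using (+-identityˡ; +-identityʳ)
open import Data.Bool using (true; false; if_then_else_)
open import Data.Product using (_×_; _,_; proj₁; proj₂; Σ; uncurry)
open import Data.Product.Properties using (,-injective)
open import Data.Sum as Sum using (_⊎_; inj₁; inj₂)
open import Data.Empty using (⊥-elim)
import Data.Fin.Properties as Fin
open import Data.List using (List; []; _∷_; _++_; map; foldr; filter; deduplicate; take; drop; reverse)
open import Data.List.Base using (allFin)
open import Data.List.Properties using (map-cong; map-∘; map-id)
open import Data.List.Relation.Unary.All as All using (All; []; _∷_)
open import Data.List.Relation.Unary.All.Properties using (All¬⇒¬Any)
import Data.List.Relation.Unary.All.Properties as All
open import Data.List.Relation.Unary.Any using (here; there)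
open import Data.List.Relation.Unary.AllPairs using (_∷_)
open import Data.List.Relation.Unary.Unique.Propositional using (Unique)
import Data.List.Relation.Unary.Unique.Propositional.Properties as Unique
open import Data.List.Relation.Unary.Unique.DecPropositional.Properties using (deduplicate-!)
open import Data.List.Membership.Propositional using (_∈_; _∉_)
open import Data.List.Membership.Propositional.Properties
  using (∈-map⁺; ∈-++⁺ˡ; ∈-++⁺ʳ; ∈-filter⁺; ∈-filter⁻; ∈-deduplicate⁺)
open import Data.Vec using (Vec; tabulate; lookup)
open import Data.Vec.Properties using (lookup∘tabulate)
open import Function using (_∘_)
open import Relation.Binary using (Decidable; DecidableEquality)
import Relation.Unary as U
open import Relation.Nullary using (Dec; does; yes; no; ¬_; ¬?; Reflects; ofʸ; ofⁿ; proof; map′; _×-dec_; _⊎-dec_; _→-dec_)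
open import Relation.Nullary.Reflects using (invert)
open import Relation.Binary.PropositionalEquality using (_≡_; refl; sym; trans; cong; cong₂; subst)

Exponent : Set
Exponent = ℕ × ℕ

_≟ₑ_ : DecidableEquality Exponent
(a , b) ≟ₑ (c , d) = map′ (uncurry (cong₂ _,_)) ,-injective (a ℕ.≟ c ×-dec b ℕ.≟ d)

open import Data.List.Membership.DecPropositional _≟ₑ_ using (_∈?_)

eqξ-reflects : ∀ ξ ζ → Reflects (ξ ≡ ζ) (eqξ ξ ζ)
eqξ-reflects (a , b) (c , d) = proof ((a , b) ≟ₑ (c , d))

-- Both coeff and sumCoeff are instances of this, with weights id and +_.
coefficientOf : {A : Set} → (A → ℤ) → List (Exponent × A) → Exponent → ℤ
coefficientOf c ts ξ = foldr (λ t acc → (if eqξ (proj₁ t) ξ then c (proj₂ t) else + 0) + acc) (+ 0) ts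

module _ {A : Set} (c : A → ℤ) where

  coefficientOf-∉ : ∀ ts {ξ} → ξ ∉ map proj₁ ts → coefficientOf c ts ξ ≡ + 0
  coefficientOf-∉ [] _ = refl
  coefficientOf-∉ ((ζ , a) ∷ ts) {ξ} ξ∉ with eqξ ζ ξ | eqξ-reflects ζ ξ
  ... | true  | ofʸ refl = ⊥-elim (ξ∉ (here refl))
  ... | false | ofⁿ _    = trans (+-identityˡ _) (coefficientOf-∉ ts (ξ∉ ∘ there))

  coefficientOf-∈ : ∀ {ts t} → Unique (map proj₁ ts) → t ∈ ts → coefficientOf c ts (proj₁ t) ≡ c (proj₂ t)
  coefficientOf-∈ {(ζ , a) ∷ ts} (ζ∉ts ∷ _) (here refl) with eqξ ζ ζ | eqξ-reflects ζ ζ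
  ... | true  | ofʸ _   = trans (cong (λ rest → c a + rest) (coefficientOf-∉ ts (All¬⇒¬Any ζ∉ts))) (+-identityʳ _)
  ... | false | ofⁿ ζ≢ζ = ⊥-elim (ζ≢ζ refl)
  coefficientOf-∈ {(ζ , a) ∷ ts} {t} (ζ∉ts ∷ unique) (there t∈ts) with eqξ ζ (proj₁ t) | eqξ-reflects ζ (proj₁ t)
  ... | true  | ofʸ ζ≡ξ = ⊥-elim (All.lookup ζ∉ts (∈-map⁺ proj₁ t∈ts) ζ≡ξ)
  ... | false | ofⁿ _   = trans (+-identityˡ _) (coefficientOf-∈ unique t∈ts)

exponents : Poly → List Exponent
exponents = map proj₁

coeff-∉ : ∀ p {ξ} → ξ ∉ exponents p → coeff p ξ ≡ + 0
coeff-∉ = coefficientOf-∉ (λ n → n)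

∀? : {P : Exponent → Set} → U.Decidable P → (ξs : List Exponent) → (∀ {ξ} → ξ ∉ ξs → P ξ) → Dec (∀ ξ → P ξ)
∀? {P} P? ξs outside = map′ everywhere (λ ∀P → All.tabulate λ {ξ} _ → ∀P ξ) (All.all? P? ξs)
  where
  everywhere : All P ξs → ∀ ξ → P ξ
  everywhere inside ξ with ξ ∈? ξs
  ... | yes ξ∈ξs = All.lookup inside ξ∈ξs
  ... | no ξ∉ξs  = outside ξ∉ξs

coeffwise₁? : {P : ℤ → Set} → U.Decidable P → P (+ 0) → ∀ p → Dec (∀ ξ → P (coeff p ξ))
coeffwise₁? {P} P? P0 p = ∀? (P? ∘ coeff p) (exponents p) λ ξ∉ → subst P (sym (coeff-∉ p ξ∉)) P0

Coeffwise : (ℤ → ℤ → Set) → Poly → Poly → Set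
Coeffwise R p q = ∀ ξ → R (coeff p ξ) (coeff q ξ)

coeffwise? : {R : ℤ → ℤ → Set} → Decidable R → R (+ 0) (+ 0) → ∀ p q → Dec (Coeffwise R p q)
coeffwise? {R} R? R00 p q = ∀? (λ ξ → R? (coeff p ξ) (coeff q ξ)) (exponents p ++ exponents q) outside
  where
  outside : ∀ {ξ} → ξ ∉ exponents p ++ exponents q → R (coeff p ξ) (coeff q ξ)
  outside ξ∉ rewrite coeff-∉ p (ξ∉ ∘ ∈-++⁺ˡ) | coeff-∉ q (ξ∉ ∘ ∈-++⁺ʳ (exponents p)) = R00

Between0And3 : ℤ → Set
Between0And3 m = m ≡ + 0 ⊎ m ≡ + 1 ⊎ m ≡ + 2 ⊎ m ≡ + 3

Cond2Coeff : ℤ → ℤ → Set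
Cond2Coeff m n = (m ≡ + 2 → n ≡ + 0) × (m ≡ + 1 ⊎ m ≡ + 3 → n ≡ + 1 ⊎ n ≡ - + 1) × (m ≡ + 0 → n ≡ + 0)

Cond3Coeff : ℤ → ℤ → Set
Cond3Coeff m n = (m ≡ + 2 → n ≡ + 0 ⊎ n ≡ + 2) × (m ≡ + 1 → n ≡ + 1 ⊎ n ≡ + 3) × (m ≡ + 3 → n ≡ + 1)

between0And3? : ∀ m → Dec (Between0And3 m)
between0And3? m = m ℤ.≟ + 0 ⊎-dec m ℤ.≟ + 1 ⊎-dec m ℤ.≟ + 2 ⊎-dec m ℤ.≟ + 3

cond2Coeff? : Decidable Cond2Coeff
cond2Coeff? m n =
  (m ℤ.≟ + 2 →-dec n ℤ.≟ + 0)
  ×-dec ((m ℤ.≟ + 1 ⊎-dec m ℤ.≟ + 3) →-dec (n ℤ.≟ + 1 ⊎-dec n ℤ.≟ - + 1))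
  ×-dec (m ℤ.≟ + 0 →-dec n ℤ.≟ + 0)

cond3Coeff? : Decidable Cond3Coeff
cond3Coeff? m n =
  (m ℤ.≟ + 2 →-dec (n ℤ.≟ + 0 ⊎-dec n ℤ.≟ + 2))
  ×-dec (m ℤ.≟ + 1 →-dec (n ℤ.≟ + 1 ⊎-dec n ℤ.≟ + 3))
  ×-dec (m ℤ.≟ + 3 →-dec n ℤ.≟ + 1)

support : Poly → List Exponent
support p = filter (λ ξ → ¬? (coeff p ξ ℤ.≟ + 0)) (deduplicate _≟ₑ_ (exponents p))

support-unique : ∀ p → Unique (support p)
support-unique p = Unique.filter⁺ _ (deduplicate-! _≟ₑ_ (exponents p))

coeff-∉-support : ∀ p {ξ} → ξ ∉ support p → coeff p ξ ≡ + 0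
coeff-∉-support p {ξ} ξ∉ with ξ ∈? exponents p | coeff p ξ ℤ.≟ + 0
... | _         | yes vanishes = vanishes
... | no ξ∉ps   | no _         = coeff-∉ p ξ∉ps
... | yes ξ∈ps  | no nonzero   = ⊥-elim (ξ∉ (∈-filter⁺ _ (∈-deduplicate⁺ _≟ₑ_ ξ∈ps) nonzero))

normalForm : Poly → List (Exponent × ℕ)
normalForm p = map (λ ξ → ξ , ∣ coeff p ξ ∣) (support p)

exponents-normalForm : ∀ p → map proj₁ (normalForm p) ≡ support p
exponents-normalForm p = trans (sym (map-∘ (support p))) (map-id (support p))

+∣m∣≡m : ∀ {m} → Between0And3 m → + ∣ m ∣ ≡ m
+∣m∣≡m (inj₁ refl)               = refl
+∣m∣≡m (inj₂ (inj₁ refl))        = refl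
+∣m∣≡m (inj₂ (inj₂ (inj₁ refl))) = refl
+∣m∣≡m (inj₂ (inj₂ (inj₂ refl))) = refl

∣m∣∈123 : ∀ {m} → Between0And3 m → ¬ m ≡ + 0 → ∣ m ∣ ≡ 1 ⊎ ∣ m ∣ ≡ 2 ⊎ ∣ m ∣ ≡ 3
∣m∣∈123 (inj₁ refl)               m≢0 = ⊥-elim (m≢0 refl)
∣m∣∈123 (inj₂ (inj₁ refl))        _   = inj₁ refl
∣m∣∈123 (inj₂ (inj₂ (inj₁ refl))) _   = inj₂ (inj₁ refl)
∣m∣∈123 (inj₂ (inj₂ (inj₂ refl))) _   = inj₂ (inj₂ refl)

isForm-normalForm : ∀ p → (∀ ξ → Between0And3 (coeff p ξ)) → IsForm (normalForm p) p
isForm-normalForm p bounded = unique , All.map⁺ (All.tabulate multiplicity) , coefficients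
  where
  unique : Unique (map proj₁ (normalForm p))
  unique = subst Unique (sym (exponents-normalForm p)) (support-unique p)

  multiplicity : ∀ {ξ} → ξ ∈ support p → ∣ coeff p ξ ∣ ≡ 1 ⊎ ∣ coeff p ξ ∣ ≡ 2 ⊎ ∣ coeff p ξ ∣ ≡ 3
  multiplicity {ξ} ξ∈ = ∣m∣∈123 (bounded ξ) (proj₂ (∈-filter⁻ _ {xs = deduplicate _≟ₑ_ (exponents p)} ξ∈))

  coefficients : ∀ ξ → coeff p ξ ≡ sumCoeff (normalForm p) ξ
  coefficients ξ with ξ ∈? support p
  ... | yes ξ∈ = sym (trans (coefficientOf-∈ +_ unique (∈-map⁺ _ ξ∈)) (+∣m∣≡m (bounded ξ)))
  ... | no ξ∉  = trans (coeff-∉-support p ξ∉)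
                   (sym (coefficientOf-∉ +_ (normalForm p) (subst (ξ ∉_) (sym (exponents-normalForm p)) ξ∉)))

module _ {L s} (form : IsForm L s) where

  coeff-multiplicity : ∀ {t n} → t ∈ L → proj₂ t ≡ n → coeff s (proj₁ t) ≡ + n
  coeff-multiplicity t∈L refl = trans (proj₂ (proj₂ form) _) (coefficientOf-∈ +_ (proj₁ form) t∈L)

  coeff-off : ∀ {ξ} → ξ ∉ map proj₁ L → coeff s ξ ≡ + 0
  coeff-off ξ∉ = trans (proj₂ (proj₂ form) _) (coefficientOf-∉ +_ L ξ∉)

  isForm⇒Cond2 : ∀ t → Coeffwise Cond2Coeff s t → Cond2 L t
  isForm⇒Cond2 _ compatible =
    All.tabulate (λ {x} x∈L →
        proj₁ (compatible (proj₁ x)) ∘ coeff-multiplicity x∈L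
      , proj₁ (proj₂ (compatible (proj₁ x))) ∘ Sum.map (coeff-multiplicity x∈L) (coeff-multiplicity x∈L))
    , λ ξ ξ∉ → proj₂ (proj₂ (compatible ξ)) (coeff-off ξ∉)

  isForm⇒Cond3 : ∀ t → Coeffwise Cond3Coeff s t → Cond3 L t
  isForm⇒Cond3 _ compatible =
    All.tabulate λ {x} x∈L →
        proj₁ (compatible (proj₁ x)) ∘ coeff-multiplicity x∈L
      , proj₁ (proj₂ (compatible (proj₁ x))) ∘ coeff-multiplicity x∈L
      , proj₂ (proj₂ (compatible (proj₁ x))) ∘ coeff-multiplicity x∈L

-- Products of operators given as functions W → W → Poly recompute the entries of
-- their factors at every use; storing each partial product as a vector evaluates
-- every entry once.
Matrix : Set
Matrix = Vec (Vec Poly 12) 12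

entry : Matrix → Op
entry M v w = lookup (lookup M v) w

memo : Op → Matrix
memo A = tabulate λ v → tabulate (A v)

_≐_ : Op → Op → Set
A ≐ B = ∀ v w → A v w ≡ B v w

entry-memo : ∀ A → entry (memo A) ≐ A
entry-memo A v w =
  trans (cong (λ row → lookup row w) (lookup∘tabulate (λ v′ → tabulate (A v′)) v)) (lookup∘tabulate (A v) w)

·ₒ-cong : ∀ {A A′ B B′} → A ≐ A′ → B ≐ B′ → (A ·ₒ B) ≐ (A′ ·ₒ B′)
·ₒ-cong A≐A′ B≐B′ v w = cong (foldr _+ₚ_ 0ₚ) (map-cong (λ u → cong₂ _*ₚ_ (A≐A′ v u) (B≐B′ u w)) (allFin 12))

_⊗_ : Matrix → Matrix → Matrix
M ⊗ N = memo (entry M ·ₒ entry N)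

entry-⊗ : ∀ M N {A B} → entry M ≐ A → entry N ≐ B → entry (M ⊗ N) ≐ (A ·ₒ B)
entry-⊗ M N M≐A N≐B v w = trans (entry-memo (entry M ·ₒ entry N) v w) (·ₒ-cong M≐A N≐B v w)

RprodM : Sign → List PosRoot → Matrix
RprodM ε = foldr (λ γ M → memo (Rop ε γ) ⊗ M) (memo idOp)

entry-RprodM : ∀ ε γs → entry (RprodM ε γs) ≐ Rprod ε γs
entry-RprodM ε []       = entry-memo idOp
entry-RprodM ε (γ ∷ γs) = entry-⊗ (memo (Rop ε γ)) (RprodM ε γs) (entry-memo (Rop ε γ)) (entry-RprodM ε γs)

SopM : Choice → ℕ → Matrix
SopM c k = RprodM plus (drop k (βs c)) ⊗ RprodM plus (take k (βs c))

TopM : Choice → Sign → ℕ → Matrix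
TopM c ε k = RprodM ε (drop k (βs c)) ⊗ RprodM (flip ε) (take k (βs c))

S'opM : Choice → ℕ → Matrix
S'opM c k = RprodM plus (reverse (take k (βs c))) ⊗ RprodM plus (reverse (drop k (βs c)))

entry-RprodM⊗RprodM : ∀ ε ε′ γs δs → entry (RprodM ε γs ⊗ RprodM ε′ δs) ≐ (Rprod ε γs ·ₒ Rprod ε′ δs)
entry-RprodM⊗RprodM ε ε′ γs δs = entry-⊗ (RprodM ε γs) (RprodM ε′ δs) (entry-RprodM ε γs) (entry-RprodM ε′ δs)

entry-SopM : ∀ c k → entry (SopM c k) ≐ Sop c k
entry-SopM c k = entry-RprodM⊗RprodM plus plus (drop k (βs c)) (take k (βs c))

entry-TopM : ∀ c ε k → entry (TopM c ε k) ≐ Top c ε k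
entry-TopM c ε k = entry-RprodM⊗RprodM ε (flip ε) (drop k (βs c)) (take k (βs c))

entry-S'opM : ∀ c k → entry (S'opM c k) ≐ S'op c k
entry-S'opM c k = entry-RprodM⊗RprodM plus plus (reverse (take k (βs c))) (reverse (drop k (βs c)))

record EntryOk (s : Poly) (t : Sign → Poly) (s′ : Poly) : Set where
  field
    bounded    : ∀ ξ → Between0And3 (coeff s ξ)
    cond2Coeff : ∀ ε → Coeffwise Cond2Coeff s (t ε)
    cond3Coeff : Coeffwise Cond3Coeff s s′

entryOk? : ∀ s t s′ → Dec (EntryOk s t s′)
entryOk? s t s′ =
  map′ (λ (b , c⁺ , c⁻ , c′) → record { bounded = b ; cond2Coeff = λ { plus → c⁺ ; minus → c⁻ } ; cond3Coeff = c′ })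
       (λ ok → let open EntryOk ok in bounded , cond2Coeff plus , cond2Coeff minus , cond3Coeff)
       (coeffwise₁? between0And3? (inj₁ refl) s
        ×-dec coeffwise? cond2Coeff? zero₂ s (t plus)
        ×-dec coeffwise? cond2Coeff? zero₂ s (t minus)
        ×-dec coeffwise? cond3Coeff? zero₃ s s′)
  where
  zero₂ : Cond2Coeff (+ 0) (+ 0)
  zero₂ = (λ ()) , (λ { (inj₁ ()) ; (inj₂ ()) }) , λ _ → refl
  zero₃ : Cond3Coeff (+ 0) (+ 0)
  zero₃ = (λ ()) , (λ ()) , λ ()

bySign : {A : Set} → A → A → Sign → A
bySign a _ plus  = a
bySign _ b minus = b

EntriesOk : Matrix → Matrix → Matrix → Matrix → Set
EntriesOk S T⁺ T⁻ S′ = ∀ v w → EntryOk (entry S v w) (λ ε → entry (bySign T⁺ T⁻ ε) v w) (entry S′ v w)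

-- The matrices are arguments here, so that each is computed only once.
entriesOk? : ∀ S T⁺ T⁻ S′ → Dec (EntriesOk S T⁺ T⁻ S′)
entriesOk? S T⁺ T⁻ S′ = Fin.all? λ v → Fin.all? λ w → entryOk? _ _ _

MatricesOk : Choice → ℕ → Set
MatricesOk c k = EntriesOk (SopM c k) (TopM c plus k) (TopM c minus k) (S'opM c k)

matricesOk? : ∀ c k → Dec (MatricesOk c k)
matricesOk? c k = entriesOk? (SopM c k) (TopM c plus k) (TopM c minus k) (S'opM c k)

-- Checking refl : does d ≡ true is much faster than solving _ : True d.
witness : {A : Set} (d : Dec A) → does d ≡ true → A
witness d does≡true = invert (subst (Reflects _) does≡true (proof d))

-- One clause per case: evaluating all fourteen cases in a single term exhausts memory.
computed : ∀ c {k} → k ≤ 6 → does (matricesOk? c k) ≡ true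
computed first z≤n = refl
computed first (s≤s z≤n) = refl
computed first (s≤s (s≤s z≤n)) = refl
computed first (s≤s (s≤s (s≤s z≤n))) = refl
computed first (s≤s (s≤s (s≤s (s≤s z≤n)))) = refl
computed first (s≤s (s≤s (s≤s (s≤s (s≤s z≤n))))) = refl
computed first (s≤s (s≤s (s≤s (s≤s (s≤s (s≤s z≤n)))))) = refl
computed second z≤n = refl
computed second (s≤s z≤n) = refl
computed second (s≤s (s≤s z≤n)) = refl
computed second (s≤s (s≤s (s≤s z≤n))) = refl
computed second (s≤s (s≤s (s≤s (s≤s z≤n)))) = refl
computed second (s≤s (s≤s (s≤s (s≤s (s≤s z≤n))))) = refl
computed second (s≤s (s≤s (s≤s (s≤s (s≤s (s≤s z≤n)))))) = refl

EntryOk-resp : ∀ {s s₁ t t₁ s′ s′₁} → s ≡ s₁ → (∀ ε → t ε ≡ t₁ ε) → s′ ≡ s′₁ → EntryOk s t s′ → EntryOk s₁ t₁ s′₁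
EntryOk-resp {s = s} refl t≗t₁ refl ok = record
  { bounded    = bounded
  ; cond2Coeff = λ ε → subst (Coeffwise Cond2Coeff s) (t≗t₁ ε) (cond2Coeff ε)
  ; cond3Coeff = cond3Coeff
  }
  where open EntryOk ok

entriesOk : ∀ c k → MatricesOk c k → ∀ v w → EntryOk (Sop c k v w) (λ ε → Top c ε k v w) (S'op c k v w)
entriesOk c k ok v w =
  EntryOk-resp (entry-SopM c k v w)
               (λ { plus → entry-TopM c plus k v w ; minus → entry-TopM c minus k v w })
               (entry-S'opM c k v w)
               (ok v w)

proposition4p5 : (c : Choice) (k : ℕ) → k ≤ 6 →
    ((v w : W) → Σ _ (λ L → IsForm L (Sop c k v w)))
    × ((v w : W) → ∀ L → IsForm L (Sop c k v w) → (ε : Sign) → Cond2 L (Top c ε k v w))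
    × ((v w : W) → ∀ L → IsForm L (Sop c k v w) → Cond3 L (S'op c k v w))
proposition4p5 c k k≤6 =
    (λ v w → normalForm (Sop c k v w) , isForm-normalForm (Sop c k v w) (bounded (ok v w)))
  , (λ v w L form ε → isForm⇒Cond2 {L} {Sop c k v w} form (Top c ε k v w) (cond2Coeff (ok v w) ε))
  , (λ v w L form → isForm⇒Cond3 {L} {Sop c k v w} form (S'op c k v w) (cond3Coeff (ok v w)))
  where
  open EntryOk
  ok : ∀ v w → EntryOk (Sop c k v w) (λ ε → Top c ε k v w) (S'op c k v w)
  ok = entriesOk c k (witness (matricesOk? c k) (computed c k≤6))
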